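{- For every integer $n \geq 2$: \begin{enumerate} \item $\gamma(P_n \times K_2) = 2\left\lceil \frac{n}{3}\right\rceil$; \item $\gamma(C_n \times K_2) = \left\lceil \frac{2n}{3}\right\rceil$ if $n$ is odd, and $\gamma(C_n \times K_2) = 2\left\lceil \frac{n}{3}\right\rceil$ if $n$ is even; \item $\gamma_s(P_n \times K_2) = 2\left\lceil \frac{3n}{7}\right\rceil$; \item $\gamma_s(C_n \times K_2) = \left\lceil \frac{6n}{7}\right\rceil$ if $n$ is odd, and $\gamma_s(C_n \times K_2) = 2\left\lceil \frac{3n}{7}\right\rceil$ if $n$ is even. \end{enumerate}
   Context: All graphs are finite and simple. For $n \ge 1$, $[n]=\{1,\dots,n\}$. $P_n$ is the path with vertex set $[n]$ and edges $\{i,i+1\}$, $1\le i\le n-1$; $C_n$ is the cycle with vertex set $[n]$ and edges $\{i,i+1\}$ ($1 \le i \le n-1$) together with $\{n,1\}$, where $C_2$ is understood as the graph on $\{1,2\}$ with the single edge $\{1,2\}$ (i.e. $C_2\cong P_2\cong K_2$); $K_m$ is the complete graph on $[m]$. The direct product $G \times H$ has vertex set $V(G)\times V(H)$, with $(g_1,h_1)$ adjacent to $(g_2,h_2)$ iff $g_1g_2 \in E(G)$ and $h_1h_2\in E(H)$. A set $D \subseteq V(G)$ is dominating if every vertex outside $D$ has a neighbor in $D$; $\gamma(G)$ is the minimum size of a dominating set. A set $S$ is a secure dominating set if it is dominating and for every $w \in V(G)\setminus S$ there is a neighbor $v\in S$ of $w$ such that $(S\setminus\{v\})\cup\{w\}$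 is dominating; $\gamma_s(G)$ is the minimum size of a secure dominating set. -}

module Defs where

open import Data.Nat using (ℕ; zero; suc; _+_; _*_; _∸_; _≤_; NonZero)
open import Data.Nat.DivMod using (_/_)
open import Data.Fin using (Fin; toℕ; remQuot)
open import Data.Fin.Subset using (Subset; _∈_; _∉_; ∣_∣; inside; outside)
open import Data.Vec using (_[_]≔_)
open import Data.Product using (_×_; Σ; ∃; ∃-syntax; proj₁; proj₂)
open import Data.Sum using (_⊎_)
open import Relation.Binary.PropositionalEquality using (_≡_; _≢_)

-- Graphs are represented by their adjacency relation on Fin N
-- (vertex i of Fin N stands for i+1 ∈ [N]).

PathAdj : (n : ℕ) → Fin n → Fin n → Set
PathAdj n i j = (suc (toℕ i) ≡ toℕ j) ⊎ (suc (toℕ j) ≡ toℕ i)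

CycleAdj : (n : ℕ) → Fin n → Fin n → Set
CycleAdj n i j = PathAdj n i j
               ⊎ ((toℕ i ≡ 0 × suc (toℕ j) ≡ n) ⊎ (toℕ j ≡ 0 × suc (toℕ i) ≡ n))

CompleteAdj : (m : ℕ) → Fin m → Fin m → Set
CompleteAdj m i j = i ≢ j

ProdAdj : (a b : ℕ) → (Fin a → Fin a → Set) → (Fin b → Fin b → Set)
        → Fin (a * b) → Fin (a * b) → Set
ProdAdj a b A B x y =
  A (proj₁ (remQuot {a} b x)) (proj₁ (remQuot {a} b y)) ×
  B (proj₂ (remQuot {a} b x)) (proj₂ (remQuot {a} b y))

Dominating : (N : ℕ) → (Fin N → Fin N → Set) → Subset N → Set
Dominating N Adj S = ∀ w → w ∉ S → ∃[ v ] (v ∈ S × Adj w v)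

SecureDominating : (N : ℕ) → (Fin N → Fin N → Set) → Subset N → Set
SecureDominating N Adj S =
  Dominating N Adj S ×
  (∀ w → w ∉ S → ∃[ v ] (v ∈ S × Adj w v ×
      Dominating N Adj ((S [ v ]≔ outside) [ w ]≔ inside)))

MinSize : (N : ℕ) → (Subset N → Set) → ℕ → Set
MinSize N P k = (∃[ S ] (P S × ∣ S ∣ ≡ k)) × (∀ S → P S → k ≤ ∣ S ∣)

DominationNumberIs : (N : ℕ) → (Fin N → Fin N → Set) → ℕ → Set
DominationNumberIs N Adj = MinSize N (Dominating N Adj)

SecureDominationNumberIs : (N : ℕ) → (Fin N → Fin N → Set) → ℕ → Set
SecureDominationNumberIs N Adj = MinSize N (SecureDominating N Adj)

⌈_/_⌉ : ℕ → (b : ℕ) → .{{NonZero b}} → ℕ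
⌈ a / b ⌉ = (a + (b ∸ 1)) / b

PnK2 : (n : ℕ) → Fin (n * 2) → Fin (n * 2) → Set
PnK2 n = ProdAdj n 2 (PathAdj n) (CompleteAdj 2)

CnK2 : (n : ℕ) → Fin (n * 2) → Fin (n * 2) → Set
CnK2 n = ProdAdj n 2 (CycleAdj n) (CompleteAdj 2)

module Submission where

-- The vertices (k , b) of Pₙ × K₂ with k + b even, and those with k + b odd, span two copies
-- of Pₙ; in Cₙ × K₂ they span two copies of Cₙ when n is even and a single C₂ₙ when n is odd.
-- Read along such a path or cycle, a vertex set S becomes a word over {void, vacant, guard},
-- and S dominates (securely dominates) exactly when every window of width 3 (width 7) of
-- these words passes a local test.  A potential on windows, verified by exhaustive
-- computation, discharges the present sites onto the guards, so such words have at least a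
-- third (three sevenths) of their present sites guarded; periodic rows of period 3
-- (period 7) attain these densities.

open import Defs
open import Data.Bool using (Bool; true; false; if_then_else_)
open import Data.Bool.Properties using (¬-not)
open import Data.Empty using (⊥-elim)
open import Data.Fin using (Fin; zero; suc; toℕ; fromℕ<; #_; opposite; combine; remQuot)
  renaming (_≟_ to _≟ᶠ_)
open import Data.Fin.Properties
  using (opposite-involutive; combine-injective; combine-surjective; remQuot-combine; combine-remQuot;
         toℕ-injective; toℕ<n; toℕ-fromℕ<)
open import Data.Fin.Subset using (Subset; _∈_; _∉_; inside; outside; ∣_∣)
open import Data.Maybe as Maybe using (Maybe; just; nothing; _<∣>_)
open import Data.Maybe.Properties using (just-injective; map-just)
open import Data.Nat
  using (ℕ; zero; suc; _+_; _*_; _≤_; _<_; _%_; _≤?_; _<?_; _<ᵇ_; z≤n; s≤s; s≤s⁻¹; z<s;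
         NonZero; >-nonZero)
open import Data.Nat.Divisibility using (divides)
open import Data.Nat.DivMod
  using (_/_; _mod_; m<n*o⇒m/o<n; +-distrib-/-∣ˡ; m*n/n≡m; m≡m%n+[m/n]*n; [m+kn]%n≡m%n; [m+n]%n≡m%n;
         m<n⇒m%n≡m; n%n≡0; m%n<n)
open import Data.Nat.Properties
open import Algebra.Properties.CommutativeSemigroup +-commutativeSemigroup
  using (xy∙z≈y∙xz; x∙yz≈y∙xz; x∙yz≈z∙xy)
open import Data.Product using (_×_; _,_; proj₁; proj₂; ∃-syntax; ∃₂)
open import Data.Sum using (_⊎_; inj₁; inj₂; [_,_]′)
open import Data.Unit using (⊤; tt)
open import Data.Vec using ([]; _∷_; lookup; tabulate; _[_]≔_)
open import Data.Vec.Properties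
  using (lookup∘tabulate; []=⇒lookup; lookup⇒[]=; []≔-updates; []≔-minimal; lookup∘update;
         lookup∘update′)
open import Function.Base using (_∘_)
open import Level using (0ℓ)
open import Relation.Binary.Core using (Rel; _⇒_)
open import Relation.Binary.Definitions using (Symmetric; DecidableEquality)
open import Relation.Binary.PropositionalEquality
  using (_≡_; _≢_; refl; sym; trans; cong; cong₂; subst; subst₂; module ≡-Reasoning)
open import Relation.Nullary using (Dec; yes; no)
open import Relation.Nullary.Decidable using (toWitness; map′; _×-dec_; _⊎-dec_; _→-dec_)

-- Words and windows

-- A position of a walk holds no vertex, a vertex outside the set, or a vertex of the set.
data Site : Set where
  void vacant guard : Site

present : Site → ℕ
present void = 0
present _    = 1

guarded : Site → ℕ
guarded guard = 1
guarded _     = 0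

_≟ₛ_ : DecidableEquality Site
void   ≟ₛ void   = yes refl
void   ≟ₛ vacant = no λ ()
void   ≟ₛ guard  = no λ ()
vacant ≟ₛ void   = no λ ()
vacant ≟ₛ vacant = yes refl
vacant ≟ₛ guard  = no λ ()
guard  ≟ₛ void   = no λ ()
guard  ≟ₛ vacant = no λ ()
guard  ≟ₛ guard  = yes refl

all-sites? : {P : Site → Set} → (∀ s → Dec (P s)) → Dec (∀ s → P s)
all-sites? P? = map′ (λ { (p , q , r) void → p ; (p , q , r) vacant → q ; (p , q , r) guard → r })
                     (λ p → p void , p vacant , p guard)
                     (P? void ×-dec P? vacant ×-dec P? guard)

Word : Set
Word = ℕ → Site

Dominated : Site → Site → Site → Set
Dominated c d e = d ≡ vacant → c ≡ guard ⊎ e ≡ guard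

SafeMove : Site → Site → Site → Set
SafeMove a b c = c ≡ guard × (b ≡ vacant → a ≡ guard)

Secured : Site → Site → Site → Site → Site → Site → Site → Set
Secured a b c d e f g = d ≡ vacant → SafeMove a b c ⊎ SafeMove g f e

DominatedAt : Word → ℕ → Set
DominatedAt w j = Dominated (w j) (w (1 + j)) (w (2 + j))

SecuredAt : Word → ℕ → Set
SecuredAt w j = Secured (w j) (w (1 + j)) (w (2 + j)) (w (3 + j)) (w (4 + j)) (w (5 + j)) (w (6 + j))

dominatedAt-cong : ∀ {w w′} j → (∀ i → w i ≡ w′ i) → DominatedAt w j → DominatedAt w′ j
dominatedAt-cong j eq dom rewrite sym (eq j) | sym (eq (1 + j)) | sym (eq (2 + j)) = dom

securedAt-cong : ∀ {w w′} j → (∀ i → w i ≡ w′ i) → SecuredAt w j → SecuredAt w′ j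
securedAt-cong j eq sec
  rewrite sym (eq j) | sym (eq (1 + j)) | sym (eq (2 + j)) | sym (eq (3 + j))
        | sym (eq (4 + j)) | sym (eq (5 + j)) | sym (eq (6 + j)) = sec

dominated? : ∀ c d e → Dec (Dominated c d e)
dominated? c d e = (d ≟ₛ vacant) →-dec ((c ≟ₛ guard) ⊎-dec (e ≟ₛ guard))

safeMove? : ∀ a b c → Dec (SafeMove a b c)
safeMove? a b c = (c ≟ₛ guard) ×-dec ((b ≟ₛ vacant) →-dec (a ≟ₛ guard))

secured? : ∀ a b c d e f g → Dec (Secured a b c d e f g)
secured? a b c d e f g = (d ≟ₛ vacant) →-dec (safeMove? a b c ⊎-dec safeMove? g f e)

dominatedAt? : ∀ w j → Dec (DominatedAt w j)
dominatedAt? w j = dominated? (w j) (w (1 + j)) (w (2 + j))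

securedAt? : ∀ w j → Dec (SecuredAt w j)
securedAt? w j = secured? (w j) (w (1 + j)) (w (2 + j)) (w (3 + j)) (w (4 + j)) (w (5 + j)) (w (6 + j))

-- Discharging

-- Potentials on two (six) consecutive sites.  Φ₇ is the least solution in ℕ of the inequalities
-- of secured-potential, found by a longest-path computation over the 3⁶ states.
Φ₃ : Site → Site → ℕ
Φ₃ void   _     = 1
Φ₃ vacant guard = 1
Φ₃ vacant _     = 0
Φ₃ guard  _     = 2

Φ₇ : Site → Site → Site → Site → Site → Site → ℕ
Φ₇ _      void   vacant void   _      _      = 0
Φ₇ _      void   vacant vacant _      _      = 0
Φ₇ _      void   vacant guard  vacant void   = 0
Φ₇ _      void   vacant guard  vacant vacant = 0
Φ₇ _      vacant vacant void   _      _      = 0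
Φ₇ _      vacant vacant vacant _      _      = 0
Φ₇ _      vacant vacant guard  vacant void   = 0
Φ₇ _      vacant vacant guard  vacant vacant = 0
Φ₇ void   void   void   _      _      _      = 9
Φ₇ void   void   vacant guard  void   _      = 9
Φ₇ void   void   vacant guard  vacant guard  = 9
Φ₇ void   void   vacant guard  guard  _      = 9
Φ₇ void   void   guard  _      _      _      = 9
Φ₇ void   vacant void   _      _      _      = 3
Φ₇ void   vacant vacant guard  void   _      = 3
Φ₇ void   vacant vacant guard  vacant guard  = 3
Φ₇ void   vacant vacant guard  guard  _      = 3
Φ₇ void   vacant guard  void   _      _      = 9
Φ₇ void   vacant guard  vacant void   _      = 3
Φ₇ void   vacant guard  vacant vacant _      = 3
Φ₇ void   vacant guard  vacant guard  _      = 9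
Φ₇ void   vacant guard  guard  _      _      = 9
Φ₇ void   guard  _      _      _      _      = 9
Φ₇ vacant void   void   _      _      _      = 6
Φ₇ vacant void   vacant guard  void   _      = 6
Φ₇ vacant void   vacant guard  vacant guard  = 6
Φ₇ vacant void   vacant guard  guard  _      = 6
Φ₇ vacant void   guard  _      _      _      = 6
Φ₇ vacant vacant void   _      _      _      = 3
Φ₇ vacant vacant vacant guard  void   _      = 3
Φ₇ vacant vacant vacant guard  vacant guard  = 3
Φ₇ vacant vacant vacant guard  guard  _      = 3
Φ₇ vacant vacant guard  void   _      _      = 6
Φ₇ vacant vacant guard  vacant void   _      = 3
Φ₇ vacant vacant guard  vacant vacant _      = 3
Φ₇ vacant vacant guard  vacant guard  _      = 6
Φ₇ vacant vacant guard  guard  _      _      = 6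
Φ₇ vacant guard  void   _      _      _      = 9
Φ₇ vacant guard  vacant void   _      _      = 7
Φ₇ vacant guard  vacant vacant _      _      = 7
Φ₇ vacant guard  vacant guard  void   _      = 9
Φ₇ vacant guard  vacant guard  vacant void   = 8
Φ₇ vacant guard  vacant guard  vacant vacant = 8
Φ₇ vacant guard  vacant guard  vacant guard  = 9
Φ₇ vacant guard  vacant guard  guard  _      = 9
Φ₇ vacant guard  guard  _      _      _      = 9
Φ₇ guard  void   void   _      _      _      = 12
Φ₇ guard  void   vacant guard  void   _      = 12
Φ₇ guard  void   vacant guard  vacant guard  = 12
Φ₇ guard  void   vacant guard  guard  _      = 12
Φ₇ guard  void   guard  _      _      _      = 12
Φ₇ guard  vacant void   _      _      _      = 10
Φ₇ guard  vacant vacant guard  void   _      = 10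
Φ₇ guard  vacant vacant guard  vacant guard  = 10
Φ₇ guard  vacant vacant guard  guard  _      = 10
Φ₇ guard  vacant guard  void   _      _      = 12
Φ₇ guard  vacant guard  vacant void   _      = 11
Φ₇ guard  vacant guard  vacant vacant _      = 11
Φ₇ guard  vacant guard  vacant guard  _      = 12
Φ₇ guard  vacant guard  guard  _      _      = 12
Φ₇ guard  guard  _      _      _      _      = 12

dominated-potential : ∀ c d e → Dominated c d e → 1 * present c + Φ₃ c d ≤ 3 * guarded c + Φ₃ d e
dominated-potential = toWitness {a? = all-sites? λ c → all-sites? λ d → all-sites? λ e →
  dominated? c d e →-dec (1 * present c + Φ₃ c d ≤? 3 * guarded c + Φ₃ d e)} _

secured-potential : ∀ a b c d e f g → Secured a b c d e f g →
                    3 * present a + Φ₇ a b c d e f ≤ 7 * guarded a + Φ₇ b c d e f g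
secured-potential = toWitness {a? = all-sites? λ a → all-sites? λ b → all-sites? λ c → all-sites? λ d →
  all-sites? λ e → all-sites? λ f → all-sites? λ g →
  secured? a b c d e f g →-dec (3 * present a + Φ₇ a b c d e f ≤? 7 * guarded a + Φ₇ b c d e f g)} _

∑ : ℕ → (ℕ → ℕ) → ℕ
∑ zero    f = 0
∑ (suc L) f = f 0 + ∑ L (λ j → f (suc j))

syntax ∑ L (λ j → e) = ∑[ j < L ] e

∑-cong : ∀ L {f g : ℕ → ℕ} → (∀ j → j < L → f j ≡ g j) → ∑ L f ≡ ∑ L g
∑-cong zero    eq = refl
∑-cong (suc L) eq = cong₂ _+_ (eq 0 (s≤s z≤n)) (∑-cong L λ j j<L → eq (suc j) (s≤s j<L))

∑-ones : ∀ L {f : ℕ → ℕ} → (∀ j → j < L → f j ≡ 1) → ∑ L f ≡ L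
∑-ones zero    eq = refl
∑-ones (suc L) eq = cong₂ _+_ (eq 0 (s≤s z≤n)) (∑-ones L λ j j<L → eq (suc j) (s≤s j<L))

∑-*ˡ : ∀ c L (f : ℕ → ℕ) → ∑[ j < L ] (c * f j) ≡ c * ∑ L f
∑-*ˡ c zero    f = sym (*-zeroʳ c)
∑-*ˡ c (suc L) f = trans (cong (c * f 0 +_) (∑-*ˡ c L (λ j → f (suc j)))) (sym (*-distribˡ-+ c (f 0) _))

∑-+ : ∀ a b (f : ℕ → ℕ) → ∑ (a + b) f ≡ ∑ a f + ∑[ j < b ] f (a + j)
∑-+ zero    b f = refl
∑-+ (suc a) b f = trans (cong (f 0 +_) (∑-+ a b (λ j → f (suc j)))) (sym (+-assoc (f 0) _ _))

∑-telescope : ∀ (f g φ : ℕ → ℕ) L → (∀ j → j < L → f j + φ j ≤ g j + φ (suc j)) →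
              ∑ L f + φ 0 ≤ ∑ L g + φ L
∑-telescope f g φ zero    step = ≤-refl
∑-telescope f g φ (suc L) step = begin
  f 0 + F + φ 0      ≡⟨ xy∙z≈y∙xz (f 0) F (φ 0) ⟩
  F + (f 0 + φ 0)    ≤⟨ +-monoʳ-≤ F (step 0 (s≤s z≤n)) ⟩
  F + (g 0 + φ 1)    ≡⟨ x∙yz≈y∙xz F (g 0) (φ 1) ⟩
  g 0 + (F + φ 1)    ≤⟨ +-monoʳ-≤ (g 0) (∑-telescope (f ∘ suc) (g ∘ suc) (φ ∘ suc) L
                                             λ j j<L → step (suc j) (s≤s j<L)) ⟩
  g 0 + (G + φ (suc L)) ≡⟨ sym (+-assoc (g 0) G _) ⟩
  g 0 + G + φ (suc L)   ∎
  where
  open ≤-Reasoning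
  F = ∑[ j < L ] f (suc j)
  G = ∑[ j < L ] g (suc j)

discharge : ∀ α β (p q φ : ℕ → ℕ) L → (∀ j → j < L → β * p j + φ j ≤ α * q j + φ (suc j)) →
            φ L ≤ φ 0 → β * ∑ L p ≤ α * ∑ L q
discharge α β p q φ L step φL≤φ0 = +-cancelʳ-≤ (φ 0) _ _ (begin
  β * ∑ L p + φ 0                 ≡⟨ cong (_+ φ 0) (∑-*ˡ β L p) ⟨
  ∑[ j < L ] (β * p j) + φ 0      ≤⟨ ∑-telescope _ _ φ L step ⟩
  ∑[ j < L ] (α * q j) + φ L      ≤⟨ +-monoʳ-≤ _ φL≤φ0 ⟩
  ∑[ j < L ] (α * q j) + φ 0      ≡⟨ cong (_+ φ 0) (∑-*ˡ α L q) ⟩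
  α * ∑ L q + φ 0                 ∎)
  where open ≤-Reasoning

Wraps : Word → ℕ → Set
Wraps w L = ∀ (i : Fin 6) → w (toℕ i + L) ≡ w (toℕ i)

⌈⌉-least : ∀ a b k → a ≤ suc b * k → ⌈ a / suc b ⌉ ≤ k
⌈⌉-least a b k a≤ = s≤s⁻¹ (m<n*o⇒m/o<n (begin
  suc (a + b)         ≡⟨ cong suc (+-comm a b) ⟩
  suc b + a           ≤⟨ +-monoʳ-≤ (suc b) (subst (a ≤_) (*-comm (suc b) k) a≤) ⟩
  suc b + k * suc b   ∎))
  where open ≤-Reasoning

⌈⌉-+ : ∀ k a b → ⌈ k * suc b + a / suc b ⌉ ≡ k + ⌈ a / suc b ⌉
⌈⌉-+ k a b = begin
  (k * suc b + a + b) / suc b       ≡⟨ cong (_/ suc b) (+-assoc (k * suc b) a b) ⟩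
  (k * suc b + (a + b)) / suc b     ≡⟨ +-distrib-/-∣ˡ (a + b) (divides k refl) ⟩
  k * suc b / suc b + (a + b) / suc b ≡⟨ cong (_+ (a + b) / suc b) (m*n/n≡m k (suc b)) ⟩
  k + (a + b) / suc b               ∎
  where open ≡-Reasoning

dominated-bound : ∀ w L → Wraps w L → (∀ j → j < L → DominatedAt w j) →
                  ⌈ ∑[ j < L ] present (w j) / 3 ⌉ ≤ ∑[ j < L ] guarded (w j)
dominated-bound w L wraps dom = ⌈⌉-least _ 2 _ (subst (_≤ 3 * ∑[ j < L ] guarded (w j)) (*-identityˡ _)
  (discharge 3 1 (λ j → present (w j)) (λ j → guarded (w j)) (λ j → Φ₃ (w j) (w (1 + j))) L
    (λ j j<L → dominated-potential _ _ _ (dom j j<L))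
    (≤-reflexive (cong₂ Φ₃ (wraps (# 0)) (wraps (# 1))))))

secured-bound : ∀ w L → Wraps w L → (∀ j → j < L → SecuredAt w j) →
                ⌈ 3 * ∑[ j < L ] present (w j) / 7 ⌉ ≤ ∑[ j < L ] guarded (w j)
secured-bound w L wraps sec = ⌈⌉-least _ 6 _
  (discharge 7 3 (λ j → present (w j)) (λ j → guarded (w j)) state L
    (λ j j<L → secured-potential _ _ _ _ _ _ _ (sec j j<L))
    (≤-reflexive wrapped))
  where
  state : ℕ → ℕ
  state j = Φ₇ (w j) (w (1 + j)) (w (2 + j)) (w (3 + j)) (w (4 + j)) (w (5 + j))
  wrapped : state L ≡ state 0
  wrapped rewrite wraps (# 0) | wraps (# 1) | wraps (# 2) | wraps (# 3) | wraps (# 4) | wraps (# 5) = refl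

-- Vertex sets read along walks

private variable
  N : ℕ
  Adj Adj′ : Rel (Fin N) 0ℓ
  S : Subset N
  m : Maybe (Fin N)
  u v w x : Fin N

member : Bool → Site
member true  = guard
member false = vacant

siteOf : Subset N → Maybe (Fin N) → Site
siteOf S nothing  = void
siteOf S (just x) = member (lookup S x)

Track : ℕ → Set
Track N = ℕ → Maybe (Fin N)

wordOf : Subset N → Track N → Word
wordOf S T j = siteOf S (T j)

∈⇒guard : x ∈ S → siteOf S (just x) ≡ guard
∈⇒guard x∈S = cong member ([]=⇒lookup x∈S)

∉⇒vacant : x ∉ S → siteOf S (just x) ≡ vacant
∉⇒vacant {x = x} {S = S} x∉S = cong member (¬-not λ lookup≡true → x∉S (lookup⇒[]= x S lookup≡true))

guard⇒∈ : siteOf S m ≡ guard → ∃[ x ] m ≡ just x × x ∈ S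
guard⇒∈ {S = S} {m = just x} eq = x , refl , lookup⇒[]= x S (member⁻¹ (lookup S x) eq)
  where
  member⁻¹ : ∀ b → member b ≡ guard → b ≡ true
  member⁻¹ true _ = refl

vacant⇒∉ : siteOf S m ≡ vacant → ∃[ x ] m ≡ just x × x ∉ S
vacant⇒∉ {S = S} {m = just x} eq = x , refl , λ x∈S → guard≢vacant (trans (sym (∈⇒guard x∈S)) eq)
  where
  guard≢vacant : guard ≢ vacant
  guard≢vacant ()

present-member : ∀ b → present (member b) ≡ 1
present-member true  = refl
present-member false = refl

present-just : {T : Track N} {i : ℕ} → T i ≡ just x → present (wordOf S T i) ≡ 1
present-just {S = S} {T = T} Ti = trans (cong (λ m → present (siteOf S m)) Ti) (present-member _)

periodic-wraps : ∀ {T : Track N} {L} → (∀ j → T (j + L) ≡ T j) → Wraps (wordOf S T) L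
periodic-wraps {S = S} period i = cong (siteOf S) (period (toℕ i))

swap : Subset N → Fin N → Fin N → Subset N
swap S v w = (S [ v ]≔ outside) [ w ]≔ inside

∈-swap-new : w ∈ swap S v w
∈-swap-new {w = w} = []≔-updates _ w

∈-swap⁺ : x ∈ S → x ≢ v → x ∈ swap S v w
∈-swap⁺ {x = x} {w = w} x∈S x≢v with x ≟ᶠ w
... | yes refl = ∈-swap-new
... | no x≢w   = []≔-minimal _ x w x≢w ([]≔-minimal _ x _ x≢v x∈S)

∈-swap⁻ : x ∈ swap S v w → x ≢ w → x ≢ v × x ∈ S
∈-swap⁻ {x = x} {S = S} {v = v} {w = w} x∈ x≢w with x ≟ᶠ v
... | yes refl = ⊥-elim (false≢true (trans (sym removed) ([]=⇒lookup x∈)))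
  where
  false≢true : false ≢ true
  false≢true ()
  removed : lookup (swap S x w) x ≡ false
  removed = trans (lookup∘update′ x≢w (S [ x ]≔ outside) inside) (lookup∘update x S outside)
... | no x≢v = x≢v , lookup⇒[]= x S (trans (sym kept) ([]=⇒lookup x∈))
  where
  kept : lookup (swap S v w) x ≡ lookup S x
  kept = trans (lookup∘update′ x≢w (S [ v ]≔ outside) inside) (lookup∘update′ x≢v S outside)

∉-swap : x ∉ S → x ≢ w → x ∉ swap S v w
∉-swap x∉S x≢w x∈ = x∉S (proj₂ (∈-swap⁻ x∈ x≢w))

dominating-mono : Adj ⇒ Adj′ → Dominating N Adj S → Dominating N Adj′ S
dominating-mono Adj⇒Adj′ dom x x∉S with dom x x∉S
... | v , v∈S , x~v = v , v∈S , Adj⇒Adj′ x~v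

secureDominating-mono : Adj ⇒ Adj′ → SecureDominating N Adj S → SecureDominating N Adj′ S
secureDominating-mono Adj⇒Adj′ (dom , secure) = dominating-mono Adj⇒Adj′ dom , λ x x∉S →
  let v , v∈S , x~v , dom′ = secure x x∉S in v , v∈S , Adj⇒Adj′ x~v , dominating-mono Adj⇒Adj′ dom′

swap-dominating : Dominating N Adj S → Adj v w →
                  (∀ {x} → x ≢ w → x ∉ S → Adj x v → ∃[ z ] z ≢ v × z ∈ S × Adj x z) →
                  Dominating N Adj (swap S v w)
swap-dominating {v = v} {w = w} dom v~w backup x x∉swap with x ≟ᶠ w | x ≟ᶠ v
... | yes refl | _        = ⊥-elim (x∉swap ∈-swap-new)
... | no _     | yes refl = w , ∈-swap-new , v~w
... | no x≢w   | no x≢v   with dom x (λ x∈S → x∉swap (∈-swap⁺ x∈S x≢v))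
...   | z , z∈S , x~z with z ≟ᶠ v
...     | no z≢v   = z , ∈-swap⁺ z∈S z≢v , x~z
...     | yes refl with backup x≢w (λ x∈S → x∉swap (∈-swap⁺ x∈S x≢v)) x~z
...       | z′ , z′≢v , z′∈S , x~z′ = z′ , ∈-swap⁺ z′∈S z′≢v , x~z′

swap-forces-guard : Dominating N Adj (swap S v x) → x ∉ S → v ∈ S → u ∉ S → u ≢ x → m ≢ just x →
                    (∀ {z} → Adj u z → z ≡ v ⊎ m ≡ just z) → siteOf S m ≡ guard
swap-forces-guard {S = S} {v = v} {x = x} dom′ x∉S v∈S u∉S u≢x m≢x only
  with dom′ _ (∉-swap u∉S u≢x)
... | z , z∈ , u~z with only u~z
...   | inj₁ refl = ⊥-elim (proj₁ (∈-swap⁻ z∈ v≢x) refl)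
  where
  v≢x : v ≢ x
  v≢x refl = x∉S v∈S
...   | inj₂ refl = ∈⇒guard (proj₂ (∈-swap⁻ z∈ λ { refl → m≢x refl }))

Apart : ℕ → Track N → Set
Apart k T = ∀ {i x} → T i ≡ just x → T (k + i) ≢ just x

record InducedWalk (Adj : Rel (Fin N) 0ℓ) (T : Track N) : Set where
  field
    neighbours : ∀ {i x y} → T (suc i) ≡ just x → Adj x y → T i ≡ just y ⊎ T (2 + i) ≡ just y
    apart₂     : Apart 2 T

guard-at : (T : Track N) {i : ℕ} → T i ≡ just x → x ∈ S → wordOf S T i ≡ guard
guard-at T Ti≡x x∈S = trans (cong (siteOf _) Ti≡x) (∈⇒guard x∈S)

vacant-at : (T : Track N) {i : ℕ} → T i ≡ just x → x ∉ S → wordOf S T i ≡ vacant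
vacant-at T Ti≡x x∉S = trans (cong (siteOf _) Ti≡x) (∉⇒vacant x∉S)

module _ {T : Track N} (walk : InducedWalk Adj T) where
  open InducedWalk walk

  dominated-necessary : Dominating N Adj S → ∀ j → DominatedAt (wordOf S T) j
  dominated-necessary dom j d-vacant with vacant⇒∉ d-vacant
  ... | x , Tx , x∉S with dom x x∉S
  ...   | v , v∈S , x~v with neighbours Tx x~v
  ...     | inj₁ Tv = inj₁ (guard-at T Tv v∈S)
  ...     | inj₂ Tv = inj₂ (guard-at T Tv v∈S)

  secured-necessary : Apart 3 T → SecureDominating N Adj S → ∀ j → SecuredAt (wordOf S T) j
  secured-necessary apart₃ (_ , secure) j d-vacant with vacant⇒∉ d-vacant
  ... | x , Tx , x∉S with secure x x∉S
  ...   | v , v∈S , x~v , dom′ with neighbours Tx x~v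
  ...     | inj₁ Tv = inj₁ (guard-at T Tv v∈S , λ b-vacant →
              let u , Tu , u∉S = vacant⇒∉ b-vacant in
              swap-forces-guard dom′ x∉S v∈S u∉S (λ { refl → apart₂ Tu Tx })
                (λ T≡x → apart₃ T≡x Tx)
                (λ u~z → [ inj₂ , (λ T≡z → inj₁ (just-injective (trans (sym T≡z) Tv))) ]′
                           (neighbours Tu u~z)))
  ...     | inj₂ Tv = inj₂ (guard-at T Tv v∈S , λ f-vacant →
              let u , Tu , u∉S = vacant⇒∉ f-vacant in
              swap-forces-guard dom′ x∉S v∈S u∉S (λ { refl → apart₂ Tx Tu })
                (λ T≡x → apart₃ Tx T≡x)
                (λ u~z → [ (λ T≡z → inj₁ (just-injective (trans (sym T≡z) Tv))) , inj₂ ]′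
                           (neighbours Tu u~z)))

record PathCover (Adj : Rel (Fin N) 0ℓ) {E : Set} (T : E → Track N) : Set where
  field
    adjacent  : ∀ {e i x y} → T e i ≡ just x → T e (suc i) ≡ just y → Adj x y
    injective : ∀ {e e′ i i′ x} → T e i ≡ just x → T e′ i′ ≡ just x → e ≡ e′ × i ≡ i′
    covers    : ∀ x → ∃₂ λ e j → T e (3 + j) ≡ just x

pathCover-mono : ∀ {E} {T : E → Track N} → Adj ⇒ Adj′ → PathCover Adj T → PathCover Adj′ T
pathCover-mono Adj⇒Adj′ cover = record
  { adjacent = λ Tx Ty → Adj⇒Adj′ (adjacent Tx Ty) ; injective = injective ; covers = covers }
  where open PathCover cover

secured⇒dominated : ∀ w j → SecuredAt w j → DominatedAt w (2 + j)
secured⇒dominated w j sec d-vacant with sec d-vacant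
... | inj₁ (c-guard , _) = inj₁ c-guard
... | inj₂ (e-guard , _) = inj₂ e-guard

module _ {E : Set} {T : E → Track N} (cover : PathCover Adj T) (Adj-sym : Symmetric Adj) where
  open PathCover cover

  dominated-sufficient : (∀ e j → DominatedAt (wordOf S (T e)) (2 + j)) → Dominating N Adj S
  dominated-sufficient dom x x∉S with covers x
  ... | e , j , Tx with dom e j (vacant-at (T e) Tx x∉S)
  ...   | inj₁ c-guard = let v , Tv , v∈S = guard⇒∈ c-guard in v , v∈S , Adj-sym (adjacent Tv Tx)
  ...   | inj₂ e-guard = let v , Tv , v∈S = guard⇒∈ e-guard in v , v∈S , adjacent Tx Tv

  module _ (walks : ∀ e → InducedWalk Adj (T e)) where

    secured-sufficient-induced : (∀ e j → SecuredAt (wordOf S (T e)) j) → SecureDominating N Adj S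
    secured-sufficient-induced {S = S} sec = dom , secure
      where
      dom : Dominating N Adj S
      dom = dominated-sufficient λ e j → secured⇒dominated (wordOf S (T e)) j (sec e j)

      secure : ∀ x → x ∉ S → ∃[ v ] v ∈ S × Adj x v × Dominating N Adj (swap S v x)
      secure x x∉S with covers x
      ... | e , j , Tx with sec e j (vacant-at (T e) Tx x∉S)
      ...   | inj₁ (c-guard , rescue) with guard⇒∈ c-guard
      ...     | v , Tv , v∈S =
        v , v∈S , Adj-sym (adjacent Tv Tx) , swap-dominating dom (adjacent Tv Tx) backup
        where
        open InducedWalk (walks e)
        backup : ∀ {y} → y ≢ x → y ∉ S → Adj y v → ∃[ z ] z ≢ v × z ∈ S × Adj y z
        backup y≢x y∉S y~v with neighbours Tv (Adj-sym y~v)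
        ... | inj₂ T≡y = ⊥-elim (y≢x (just-injective (trans (sym T≡y) Tx)))
        ... | inj₁ Ty with guard⇒∈ (rescue (vacant-at (T e) Ty y∉S))
        ...   | z , Tz , z∈S = z , (λ { refl → apart₂ Tz Tv }) , z∈S , Adj-sym (adjacent Tz Ty)
      secure x x∉S | e , j , Tx | inj₂ (e-guard , rescue) with guard⇒∈ e-guard
      ...     | v , Tv , v∈S =
        v , v∈S , adjacent Tx Tv , swap-dominating dom (Adj-sym (adjacent Tx Tv)) backup
        where
        open InducedWalk (walks e)
        backup : ∀ {y} → y ≢ x → y ∉ S → Adj y v → ∃[ z ] z ≢ v × z ∈ S × Adj y z
        backup y≢x y∉S y~v with neighbours Tv (Adj-sym y~v)
        ... | inj₁ T≡y = ⊥-elim (y≢x (just-injective (trans (sym T≡y) Tx)))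
        ... | inj₂ Ty with guard⇒∈ (rescue (vacant-at (T e) Ty y∉S))
        ...   | z , Tz , z∈S = z , (λ { refl → apart₂ Tv Tz }) , z∈S , adjacent Ty Tz

Consecutive : {E : Set} → (E → Track N) → Rel (Fin N) 0ℓ
Consecutive T x y = ∃₂ λ e i → T e i ≡ just x × T e (suc i) ≡ just y

TrackAdj : {E : Set} → (E → Track N) → Rel (Fin N) 0ℓ
TrackAdj T x y = Consecutive T x y ⊎ Consecutive T y x

trackAdj-sym : {E : Set} (T : E → Track N) → Symmetric (TrackAdj T)
trackAdj-sym T (inj₁ xy) = inj₂ xy
trackAdj-sym T (inj₂ yx) = inj₁ yx

module _ {E : Set} {T : E → Track N} (cover : PathCover Adj T) where
  open PathCover cover

  trackAdj⇒ : Symmetric Adj → TrackAdj T ⇒ Adj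
  trackAdj⇒ Adj-sym (inj₁ (_ , _ , Tx , Ty)) = adjacent Tx Ty
  trackAdj⇒ Adj-sym (inj₂ (_ , _ , Ty , Tx)) = Adj-sym (adjacent Ty Tx)

  trackCover : PathCover (TrackAdj T) T
  trackCover = record
    { adjacent  = λ Tx Ty → inj₁ (_ , _ , Tx , Ty)
    ; injective = injective
    ; covers    = covers
    }

  trackWalk : ∀ e → InducedWalk (TrackAdj T) (T e)
  trackWalk e = record { neighbours = neighbours ; apart₂ = apart 1 }
    where
    neighbours : ∀ {i x y} → T e (suc i) ≡ just x → TrackAdj T x y →
                 T e i ≡ just y ⊎ T e (2 + i) ≡ just y
    neighbours Tx (inj₁ (_ , _ , T′x , T′y)) with injective T′x Tx
    ... | refl , refl = inj₂ T′y
    neighbours Tx (inj₂ (_ , _ , T′y , T′x)) with injective T′x Tx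
    ... | refl , refl = inj₁ T′y
    apart : ∀ k {i x} → T e i ≡ just x → T e (suc k + i) ≢ just x
    apart k Tx Tkx = <⇒≢ (m<n+m _ z<s) (proj₂ (injective Tx Tkx))

  -- Every track is induced in the graph of the cover itself, and further edges only help.
  secured-sufficient : Symmetric Adj → (∀ e j → SecuredAt (wordOf S (T e)) j) → SecureDominating N Adj S
  secured-sufficient Adj-sym sec = secureDominating-mono (trackAdj⇒ Adj-sym)
    (secured-sufficient-induced trackCover (trackAdj-sym T) trackWalk sec)

-- Direct products with K₂

layer : Fin 2 → ℕ → Fin 2
layer e zero          = e
layer e (suc zero)    = opposite e
layer e (suc (suc j)) = layer e j

opposite-≢ : (b : Fin 2) → opposite b ≢ b
opposite-≢ zero       ()
opposite-≢ (suc zero) ()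

≢⇒opposite : {b b′ : Fin 2} → b ≢ b′ → b′ ≡ opposite b
≢⇒opposite {zero}     {zero}     b≢b′ = ⊥-elim (b≢b′ refl)
≢⇒opposite {zero}     {suc zero} _    = refl
≢⇒opposite {suc zero} {zero}     _    = refl
≢⇒opposite {suc zero} {suc zero} b≢b′ = ⊥-elim (b≢b′ refl)

layer-suc : ∀ e j → layer e (suc j) ≡ opposite (layer e j)
layer-suc e zero          = refl
layer-suc e (suc zero)    = sym (opposite-involutive e)
layer-suc e (suc (suc j)) = layer-suc e j

layer-opposite : ∀ e j → layer (opposite e) j ≡ opposite (layer e j)
layer-opposite e zero          = refl
layer-opposite e (suc zero)    = refl
layer-opposite e (suc (suc j)) = layer-opposite e j

layer-+ : ∀ e i j → layer e (i + j) ≡ layer (layer e i) j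
layer-+ e zero          j = refl
layer-+ e (suc zero)    j = trans (layer-suc e j) (sym (layer-opposite e j))
layer-+ e (suc (suc i)) j = layer-+ e i j

layer-involutive : ∀ e j → layer (layer e j) j ≡ e
layer-involutive e zero          = refl
layer-involutive e (suc zero)    = opposite-involutive e
layer-involutive e (suc (suc j)) = layer-involutive e j

layer-injective : ∀ {e e′} j → layer e j ≡ layer e′ j → e ≡ e′
layer-injective {e} {e′} j eq =
  trans (sym (layer-involutive e j)) (trans (cong (λ b → layer b j) eq) (layer-involutive e′ j))

layer-double : ∀ e n → layer e (n + n) ≡ e
layer-double e n = trans (layer-+ e n n) (layer-involutive e n)

layer-even : ∀ e n → n % 2 ≡ 0 → layer e n ≡ e
layer-even e zero          _ = refl
layer-even e (suc (suc n)) p = layer-even e n p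

layer-odd : ∀ e n → n % 2 ≡ 1 → layer e n ≡ opposite e
layer-odd e (suc zero)    _ = refl
layer-odd e (suc (suc n)) p = layer-odd e n p

_×K₂ : ∀ {n} → Rel (Fin n) 0ℓ → Rel (Fin (n * 2)) 0ℓ
_×K₂ {n} A = ProdAdj n 2 A (CompleteAdj 2)

module _ {n : ℕ} (A : Rel (Fin n) 0ℓ) where

  private
    Layered : Fin n × Fin 2 → Fin n × Fin 2 → Set
    Layered (c , b) (c′ , b′) = A c c′ × b ≢ b′

  ×K₂-intro : ∀ {c c′ b b′} → A c c′ → b ≢ b′ → (A ×K₂) (combine c b) (combine c′ b′)
  ×K₂-intro {c} {c′} {b} {b′} a b≢b′ =
    subst₂ Layered (sym (remQuot-combine c b)) (sym (remQuot-combine c′ b′)) (a , b≢b′)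

  ×K₂-elim : ∀ {c b y} → (A ×K₂) (combine c b) y →
             ∃₂ λ c′ b′ → y ≡ combine c′ b′ × A c c′ × b ≢ b′
  ×K₂-elim {c} {b} {y} c~y =
    proj₁ (remQuot {n} 2 y) , proj₂ (remQuot {n} 2 y) , sym (combine-remQuot {n} 2 y) ,
    subst (λ p → Layered p (remQuot {n} 2 y)) (remQuot-combine c b) c~y

  ×K₂-sym : Symmetric A → Symmetric (A ×K₂)
  ×K₂-sym A-sym {x} {y} (a , b≢b′) = A-sym a , λ b′≡b → b≢b′ (sym b′≡b)

×K₂-mono : ∀ {n} {A A′ : Rel (Fin n) 0ℓ} → A ⇒ A′ → A ×K₂ ⇒ A′ ×K₂
×K₂-mono A⇒A′ (a , b≢b′) = A⇒A′ a , b≢b′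

lift : ∀ {n} → Fin 2 → (ℕ → Maybe (Fin n)) → Track (n * 2)
lift e B i = Maybe.map (λ c → combine c (layer e i)) (B i)

module _ {n : ℕ} (B : ℕ → Maybe (Fin n)) (e : Fin 2) where

  lift-just : ∀ {i x} → lift e B i ≡ just x → ∃[ c ] B i ≡ just c × x ≡ combine c (layer e i)
  lift-just {i} eq with B i
  ... | just c = c , refl , sym (just-injective eq)

  lift-at : ∀ {i c} → B i ≡ just c → lift e B i ≡ just (combine c (layer e i))
  lift-at = map-just

  lift-induced : {A : Rel (Fin n) 0ℓ} → InducedWalk A B → InducedWalk (A ×K₂) (lift e B)
  lift-induced {A} walk = record { neighbours = neighbours′ ; apart₂ = apart₂′ }
    where
    open InducedWalk walk
    neighbours′ : ∀ {i x y} → lift e B (suc i) ≡ just x → (A ×K₂) x y →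
                  lift e B i ≡ just y ⊎ lift e B (2 + i) ≡ just y
    neighbours′ {i} {y = y} Tx x~y with lift-just Tx
    ... | c , Bc , refl with ×K₂-elim A {c} {layer e (suc i)} {y} x~y
    ...   | c′ , b′ , refl , c~c′ , b≢b′
      rewrite ≢⇒opposite b≢b′ | layer-suc e i | opposite-involutive (layer e i) with neighbours Bc c~c′
    ...     | inj₁ Bc′ = inj₁ (lift-at Bc′)
    ...     | inj₂ Bc′ = inj₂ (lift-at Bc′)
    apart₂′ : Apart 2 (lift e B)
    apart₂′ Tx T2x with lift-just Tx | lift-just T2x
    ... | c , Bc , refl | c′ , Bc′ , eq =
      apart₂ Bc (trans Bc′ (cong just (sym (proj₁ (combine-injective c _ c′ _ eq)))))

  lift-adjacent : {A : Rel (Fin n) 0ℓ} →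
                  (∀ {i c c′} → B i ≡ just c → B (suc i) ≡ just c′ → A c c′) →
                  ∀ {i x y} → lift e B i ≡ just x → lift e B (suc i) ≡ just y → (A ×K₂) x y
  lift-adjacent {A} step {i} Tx Ty with lift-just Tx | lift-just Ty
  ... | c , Bc , refl | c′ , Bc′ , refl =
    ×K₂-intro A (step Bc Bc′) λ eq → opposite-≢ (layer e i) (sym (trans eq (layer-suc e i)))

  lift-apart₃ : Apart 3 (lift e B)
  lift-apart₃ {i} Tx T3x with lift-just Tx | lift-just T3x
  ... | c , _ , refl | c′ , _ , eq =
    opposite-≢ (layer e i) (trans (sym (layer-suc e i)) (sym (proj₂ (combine-injective c _ c′ _ eq))))

-- Paths and cycles

pathAdj-sym : ∀ n → Symmetric (PathAdj n)
pathAdj-sym n (inj₁ i+1≡j) = inj₂ i+1≡j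
pathAdj-sym n (inj₂ j+1≡i) = inj₁ j+1≡i

cycleAdj-sym : ∀ n → Symmetric (CycleAdj n)
cycleAdj-sym n (inj₁ p)        = inj₁ (pathAdj-sym n p)
cycleAdj-sym n (inj₂ (inj₁ p)) = inj₂ (inj₂ p)
cycleAdj-sym n (inj₂ (inj₂ p)) = inj₂ (inj₁ p)

cycle₂⇒path₂ : CycleAdj 2 ⇒ PathAdj 2
cycle₂⇒path₂ (inj₁ p)                    = p
cycle₂⇒path₂ (inj₂ (inj₁ (i≡0 , j+1≡2))) = inj₁ (trans (cong suc i≡0) (sym (suc-injective j+1≡2)))
cycle₂⇒path₂ (inj₂ (inj₂ (j≡0 , i+1≡2))) = inj₂ (trans (cong suc j≡0) (sym (suc-injective i+1≡2)))

linePath : ℕ → (n : ℕ) → ℕ → Maybe (Fin n)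
linePath (suc o) n       zero    = nothing
linePath (suc o) n       (suc i) = linePath o n i
linePath zero    zero    i       = nothing
linePath zero    (suc n) zero    = just zero
linePath zero    (suc n) (suc i) = Maybe.map suc (linePath zero n i)

module _ {n : ℕ} where

  linePath-just : ∀ o {i} {c : Fin n} → linePath o n i ≡ just c → i ≡ o + toℕ c
  linePath-just (suc o) {suc i} eq = cong suc (linePath-just o eq)
  linePath-just zero {i} {c} eq = go n i c eq
    where
    go : ∀ n i (c : Fin n) → linePath zero n i ≡ just c → i ≡ toℕ c
    go (suc n) zero    zero    refl = refl
    go (suc n) (suc i) c          eq   with linePath zero n i in eq′
    go (suc n) (suc i) .(suc c′) refl | just c′ = cong suc (go n i c′ eq′)

  linePath-at : ∀ o (c : Fin n) {i} → i ≡ o + toℕ c → linePath o n i ≡ just c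
  linePath-at (suc o) c refl = linePath-at o c refl
  linePath-at zero    c refl = go n c
    where
    go : ∀ n (c : Fin n) → linePath zero n (toℕ c) ≡ just c
    go (suc n) zero    = refl
    go (suc n) (suc c) = cong (Maybe.map suc) (go n c)

  linePath-nothing : ∀ o {i} → (∀ (c : Fin n) → i ≢ o + toℕ c) → linePath o n i ≡ nothing
  linePath-nothing o {i} off with linePath o n i in eq
  ... | nothing = refl
  ... | just c  = ⊥-elim (off c (linePath-just o eq))

  linePath-beyond : ∀ {k} → n ≤ k → linePath 0 n k ≡ nothing
  linePath-beyond n≤k = linePath-nothing 0 λ c k≡c → <⇒≱ (toℕ<n c) (subst (n ≤_) k≡c n≤k)

  linePath-adjacent : ∀ o {i} {c c′ : Fin n} →
                      linePath o n i ≡ just c → linePath o n (suc i) ≡ just c′ → PathAdj n c c′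
  linePath-adjacent o {i} {c} {c′} Lc Lc′ = inj₁ (+-cancelˡ-≡ o _ _ (begin
    o + suc (toℕ c)  ≡⟨ +-suc o (toℕ c) ⟩
    suc (o + toℕ c)  ≡⟨ cong suc (linePath-just o Lc) ⟨
    suc i            ≡⟨ linePath-just o Lc′ ⟩
    o + toℕ c′       ∎))
    where open ≡-Reasoning

  linePath-induced : ∀ o → InducedWalk (PathAdj n) (linePath o n)
  linePath-induced o = record { neighbours = neighbours ; apart₂ = apart₂ }
    where
    neighbours : ∀ {i c c′} → linePath o n (suc i) ≡ just c → PathAdj n c c′ →
                 linePath o n i ≡ just c′ ⊎ linePath o n (2 + i) ≡ just c′
    neighbours {i} {c} {c′} Lc (inj₁ c+1≡c′) = inj₂ (linePath-at o c′ (begin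
      suc (suc i)       ≡⟨ cong suc (linePath-just o Lc) ⟩
      suc (o + toℕ c)   ≡⟨ +-suc o (toℕ c) ⟨
      o + suc (toℕ c)   ≡⟨ cong (o +_) c+1≡c′ ⟩
      o + toℕ c′        ∎))
      where open ≡-Reasoning
    neighbours {i} {c} {c′} Lc (inj₂ c′+1≡c) = inj₁ (linePath-at o c′ (suc-injective (begin
      suc i              ≡⟨ linePath-just o Lc ⟩
      o + toℕ c          ≡⟨ cong (o +_) c′+1≡c ⟨
      o + suc (toℕ c′)   ≡⟨ +-suc o (toℕ c′) ⟩
      suc (o + toℕ c′)   ∎)))
      where open ≡-Reasoning
    apart₂ : Apart 2 (linePath o n)
    apart₂ {i} Lc L2c = <⇒≢ (m<n+m i z<s) (trans (linePath-just o Lc) (sym (linePath-just o L2c)))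

linePath-below : ∀ {n k} → k < n → ∃[ c ] linePath 0 n k ≡ just c
linePath-below k<n = fromℕ< k<n , linePath-at 0 _ (sym (toℕ-fromℕ< k<n))

linePath-shift : ∀ o {n i} → linePath o n (o + i) ≡ linePath 0 n i
linePath-shift zero    = refl
linePath-shift (suc o) = linePath-shift o

copyWalk : ∀ n → Fin 2 → Track (n * 2)
copyWalk n e = lift e (linePath 0 n)

inCopy : ∀ n → Subset (n * 2) → Fin 2 → ℕ
inCopy n S e = ∑[ k < n ] guarded (wordOf S (copyWalk n e) k)

∣S∣≡inCopy₀+inCopy₁ : ∀ n (S : Subset (n * 2)) → ∣ S ∣ ≡ inCopy n S zero + inCopy n S (suc zero)
∣S∣≡inCopy₀+inCopy₁ zero    []            = refl
∣S∣≡inCopy₀+inCopy₁ (suc n) (b₀ ∷ b₁ ∷ S) = begin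
  ∣ b₀ ∷ b₁ ∷ S ∣           ≡⟨ trans (∣∷∣ b₀ (b₁ ∷ S)) (cong (g b₀ +_) (∣∷∣ b₁ S)) ⟩
  g b₀ + (g b₁ + ∣ S ∣)     ≡⟨ cong (λ s → g b₀ + (g b₁ + s)) (∣S∣≡inCopy₀+inCopy₁ n S) ⟩
  g b₀ + (g b₁ + (A₀ + A₁)) ≡⟨ cong (g b₀ +_) (x∙yz≈z∙xy (g b₁) A₀ A₁) ⟩
  g b₀ + (A₁ + (g b₁ + A₀)) ≡⟨ +-assoc (g b₀) A₁ _ ⟨
  (g b₀ + A₁) + (g b₁ + A₀) ≡⟨ cong₂ _+_ (cong (g b₀ +_) (shift zero)) (cong (g b₁ +_) (shift (suc zero))) ⟩
  inCopy (suc n) (b₀ ∷ b₁ ∷ S) zero + inCopy (suc n) (b₀ ∷ b₁ ∷ S) (suc zero) ∎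
  where
  open ≡-Reasoning
  A₀ = inCopy n S zero
  A₁ = inCopy n S (suc zero)
  g : Bool → ℕ
  g b = guarded (member b)
  ∣∷∣ : ∀ {m} b (p : Subset m) → ∣ b ∷ p ∣ ≡ g b + ∣ p ∣
  ∣∷∣ true  p = refl
  ∣∷∣ false p = refl
  step : ∀ e k → wordOf S (copyWalk n (opposite e)) k ≡
                  wordOf (b₀ ∷ b₁ ∷ S) (copyWalk (suc n) e) (suc k)
  step e k with linePath 0 n k
  ... | nothing = refl
  ... | just c  = cong (λ b → member (lookup S (combine c b))) (trans (layer-opposite e k) (sym (layer-suc e k)))
  shift : ∀ e → inCopy n S (opposite e) ≡
                 ∑[ k < n ] guarded (wordOf (b₀ ∷ b₁ ∷ S) (copyWalk (suc n) e) (suc k))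
  shift e = ∑-cong n λ k _ → cong guarded (step e k)

cycleWalk : ∀ n .{{_ : NonZero n}} → ℕ → Maybe (Fin n)
cycleWalk n i = just (i mod n)

module _ {n : ℕ} .{{_ : NonZero n}} where

  suc-% : ∀ m → suc m % n ≡ suc (m % n) % n
  suc-% m = trans (cong (λ k → suc k % n) (m≡m%n+[m/n]*n m n)) ([m+kn]%n≡m%n (suc (m % n)) (m / n) n)

  private
    below : ∀ {k l} → k ≡ l → l < n → k % n ≡ l
    below refl = m<n⇒m%n≡m
    round : ∀ {k} → k ≡ n → k % n ≡ 0
    round refl = n%n≡0 n

  suc-%-cases : ∀ {r} → r < n → (suc r < n × suc r % n ≡ suc r) ⊎ (suc r ≡ n × suc r % n ≡ 0)
  suc-%-cases {r} r<n with m≤n⇒m<n∨m≡n r<n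
  ... | inj₁ r+1<n = inj₁ (r+1<n , below refl r+1<n)
  ... | inj₂ r+1≡n = inj₂ (r+1≡n , round r+1≡n)

  suc-%-injective : ∀ {r s} → r < n → s < n → suc r % n ≡ suc s % n → r ≡ s
  suc-%-injective r<n s<n eq with suc-%-cases r<n | suc-%-cases s<n
  ... | inj₁ (_ , r′) | inj₁ (_ , s′) = suc-injective (trans (sym r′) (trans eq s′))
  ... | inj₂ (r+1≡n , _) | inj₂ (s+1≡n , _) = suc-injective (trans r+1≡n (sym s+1≡n))
  ... | inj₁ (_ , r′) | inj₂ (_ , s′) with trans (sym r′) (trans eq s′)
  ...   | ()
  suc-%-injective r<n s<n eq | inj₂ (_ , r′) | inj₁ (_ , s′) with trans (sym s′) (trans (sym eq) r′)
  ...   | ()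

  cycleAdj⇒ : ∀ {c c′ : Fin n} → CycleAdj n c c′ →
              toℕ c′ ≡ suc (toℕ c) % n ⊎ toℕ c ≡ suc (toℕ c′) % n
  cycleAdj⇒ {c′ = c′} (inj₁ (inj₁ c+1≡c′)) = inj₁ (sym (below c+1≡c′ (toℕ<n c′)))
  cycleAdj⇒ {c = c}   (inj₁ (inj₂ c′+1≡c)) = inj₂ (sym (below c′+1≡c (toℕ<n c)))
  cycleAdj⇒ (inj₂ (inj₁ (c≡0 , c′+1≡n)))   = inj₂ (trans c≡0 (sym (round c′+1≡n)))
  cycleAdj⇒ (inj₂ (inj₂ (c′≡0 , c+1≡n)))   = inj₁ (trans c′≡0 (sym (round c+1≡n)))

  toℕ-mod : ∀ i → toℕ (i mod n) ≡ i % n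
  toℕ-mod i = toℕ-fromℕ< _

  mod-≡ : ∀ {i} {c : Fin n} → i % n ≡ toℕ c → i mod n ≡ c
  mod-≡ {i} eq = toℕ-injective (trans (toℕ-mod i) eq)

  %-apart₂ : 3 ≤ n → ∀ i → suc (suc i) % n ≢ i % n
  %-apart₂ 3≤n i eq = two-steps≢ (m%n<n i n) (begin
    suc (suc (i % n) % n) % n  ≡⟨ cong (λ t → suc t % n) (suc-% i) ⟨
    suc (suc i % n) % n        ≡⟨ suc-% (suc i) ⟨
    suc (suc i) % n            ≡⟨ eq ⟩
    i % n                      ∎)
    where
    open ≡-Reasoning
    n≢2 : n ≢ 2
    n≢2 n≡2 = <⇒≱ 3≤n (≤-reflexive n≡2)
    two-steps≢ : ∀ {r} → r < n → suc (suc r % n) % n ≢ r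
    two-steps≢ {r} r<n back with suc-%-cases r<n
    ... | inj₂ (r+1≡n , r+1) = n≢2 (trans (sym r+1≡n) (cong suc r≡1))
      where
      r≡1 : r ≡ 1
      r≡1 = trans (sym back) (trans (cong (λ t → suc t % n) r+1) (below refl (<⇒≤ 3≤n)))
    ... | inj₁ (r+1<n , r+1) with suc-%-cases r+1<n
    ...   | inj₁ (_ , r+2)     = <⇒≢ (m<n+m r z<s) (trans (sym back′) r+2)
      where
      back′ : suc (suc r) % n ≡ r
      back′ = trans (cong (λ t → suc t % n) (sym r+1)) back
    ...   | inj₂ (r+2≡n , r+2) = n≢2 (trans (sym r+2≡n) (cong (λ t → suc (suc t)) r≡0))
      where
      r≡0 : r ≡ 0
      r≡0 = trans (sym (trans (cong (λ t → suc t % n) (sym r+1)) back)) r+2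

  cycleWalk-induced : 3 ≤ n → InducedWalk (CycleAdj n) (cycleWalk n)
  cycleWalk-induced 3≤n = record { neighbours = neighbours ; apart₂ = apart₂ }
    where
    neighbours : ∀ {i c c′} → cycleWalk n (suc i) ≡ just c → CycleAdj n c c′ →
                 cycleWalk n i ≡ just c′ ⊎ cycleWalk n (2 + i) ≡ just c′
    neighbours {i} refl c~c′ with cycleAdj⇒ c~c′
    ... | inj₁ c′≡ = inj₂ (cong just (mod-≡ (sym (begin
      toℕ _                      ≡⟨ c′≡ ⟩
      suc (toℕ (suc i mod n)) % n ≡⟨ cong (λ r → suc r % n) (toℕ-mod (suc i)) ⟩
      suc (suc i % n) % n        ≡⟨ suc-% (suc i) ⟨
      suc (suc i) % n            ∎))))
      where open ≡-Reasoning
    ... | inj₂ ≡c′ = inj₁ (cong just (mod-≡ (suc-%-injective (m%n<n i n) (toℕ<n _) (begin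
      suc (i % n) % n            ≡⟨ suc-% i ⟨
      suc i % n                  ≡⟨ toℕ-mod (suc i) ⟨
      toℕ (suc i mod n)          ≡⟨ ≡c′ ⟩
      suc (toℕ _) % n            ∎))))
      where open ≡-Reasoning
    apart₂ : Apart 2 (cycleWalk n)
    apart₂ {i} refl eq =
      %-apart₂ 3≤n i (trans (sym (toℕ-mod (2 + i))) (trans (cong toℕ (just-injective eq)) (toℕ-mod i)))

  cycleWalk-period : ∀ j → cycleWalk n (j + n) ≡ cycleWalk n j
  cycleWalk-period j = cong just (mod-≡ (trans ([m+n]%n≡m%n j n) (sym (toℕ-mod j))))

  cycleWalk-lap : ∀ k → cycleWalk n (n + k) ≡ cycleWalk n k
  cycleWalk-lap k = trans (cong (cycleWalk n) (+-comm n k)) (cycleWalk-period k)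

  cycleWalk-below : ∀ {k} → k < n → cycleWalk n k ≡ linePath 0 n k
  cycleWalk-below {k} k<n = sym (linePath-at 0 (k mod n) (sym (trans (toℕ-mod k) (m<n⇒m%n≡m k<n))))

cycleTrack : ∀ n .{{_ : NonZero n}} → Fin 2 → Track (n * 2)
cycleTrack n e = lift e (cycleWalk n)

module _ {n : ℕ} .{{_ : NonZero n}} (e : Fin 2) where

  cycleTrack-even-period : n % 2 ≡ 0 → ∀ j → cycleTrack n e (j + n) ≡ cycleTrack n e j
  cycleTrack-even-period even j = cong₂ (λ m b → Maybe.map (λ c → combine c b) m)
    (cycleWalk-period j) (trans (layer-+ e j n) (layer-even (layer e j) n even))

  cycleTrack-double-period : ∀ j → cycleTrack n e (j + (n + n)) ≡ cycleTrack n e j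
  cycleTrack-double-period j = cong₂ (λ m b → Maybe.map (λ c → combine c b) m)
    (trans (cong (cycleWalk n) (sym (+-assoc j n n))) (trans (cycleWalk-period (j + n)) (cycleWalk-period j)))
    (trans (layer-+ e j (n + n)) (layer-double (layer e j) n))

  cycleTrack-first-lap : ∀ {k} → k < n → cycleTrack n e k ≡ copyWalk n e k
  cycleTrack-first-lap {k} k<n = cong (Maybe.map (λ c → combine c (layer e k))) (cycleWalk-below k<n)

  cycleTrack-second-lap : ∀ {k} → k < n → cycleTrack n e (n + k) ≡ copyWalk n (layer e n) k
  cycleTrack-second-lap {k} k<n = cong₂ (λ m b → Maybe.map (λ c → combine c b) m)
    (trans (cycleWalk-lap k) (cycleWalk-below k<n)) (layer-+ e n k)

  cycle-present : ∀ (S : Subset (n * 2)) L → ∑[ j < L ] present (wordOf S (cycleTrack n e) j) ≡ L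
  cycle-present S L = ∑-ones L λ j _ → present-member _

  cycle-lap : ∀ (S : Subset (n * 2)) → ∑[ j < n ] guarded (wordOf S (cycleTrack n e) j) ≡ inCopy n S e
  cycle-lap S = ∑-cong n λ k k<n → cong (guarded ∘ siteOf S) (cycleTrack-first-lap k<n)

  cycle-laps : ∀ (S : Subset (n * 2)) →
               ∑[ j < n + n ] guarded (wordOf S (cycleTrack n e) j) ≡ inCopy n S e + inCopy n S (layer e n)
  cycle-laps S = trans (∑-+ n n _) (cong₂ _+_ (cycle-lap S)
    (∑-cong n λ k k<n → cong (guarded ∘ siteOf S) (cycleTrack-second-lap k<n)))

-- The six leading void sites make the potential state all-void at both ends of the word.
pathTrack : ∀ n → Fin 2 → Track (n * 2)
pathTrack n e = lift e (linePath 6 n)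

module _ {n : ℕ} (S : Subset (n * 2)) (e : Fin 2) where

  path-wraps : Wraps (wordOf S (pathTrack n e)) (6 + n)
  path-wraps i = trans (void-at beyond) (sym (void-at before))
    where
    void-at : ∀ {j} → (∀ (c : Fin n) → j ≢ 6 + toℕ c) → wordOf S (pathTrack n e) j ≡ void
    void-at {j} off = cong (λ m → siteOf S (Maybe.map (λ c → combine c (layer e j)) m)) (linePath-nothing 6 off)
    beyond : ∀ (c : Fin n) → toℕ i + (6 + n) ≢ 6 + toℕ c
    beyond c eq = <⇒≢ (≤-trans (+-monoʳ-< 6 (toℕ<n c)) (m≤n+m (6 + n) (toℕ i))) (sym eq)
    before : ∀ (c : Fin n) → toℕ i ≢ 6 + toℕ c
    before c eq = <⇒≱ (toℕ<n i) (≤-trans (m≤m+n 6 (toℕ c)) (≤-reflexive (sym eq)))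

  path-present : ∑[ j < 6 + n ] present (wordOf S (pathTrack n e) j) ≡ n
  path-present = ∑-ones n λ k k<n →
    present-just {T = copyWalk n e} (lift-at (linePath 0 n) e (proj₂ (linePath-below k<n)))

pathCover : ∀ n → PathCover (PathAdj n ×K₂) (pathTrack n)
pathCover n = record
  { adjacent  = λ {e} {i} → lift-adjacent (linePath 6 n) e (λ {i} → linePath-adjacent 6 {i}) {i}
  ; injective = injective
  ; covers    = covers
  }
  where
  injective : ∀ {e e′ i i′ x} → pathTrack n e i ≡ just x → pathTrack n e′ i′ ≡ just x →
              e ≡ e′ × i ≡ i′
  injective {e} {e′} {i} {i′} Tx T′x
    with lift-just (linePath 6 n) e {i} Tx | lift-just (linePath 6 n) e′ {i′} T′x
  ... | c , Lc , refl | c′ , Lc′ , eq with combine-injective c _ c′ _ eq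
  ...   | refl , layers with trans (linePath-just 6 {i} Lc) (sym (linePath-just 6 {i′} Lc′))
  ...     | refl = layer-injective i layers , refl
  covers : ∀ x → ∃₂ λ e j → pathTrack n e (3 + j) ≡ just x
  covers x with combine-surjective {n} {2} x
  ... | c , b , refl = layer b (toℕ c) , 3 + toℕ c ,
    trans (lift-at (linePath 6 n) (layer b (toℕ c)) {6 + toℕ c} (linePath-at 6 c refl))
          (cong (λ b′ → just (combine c b′)) (layer-involutive b (toℕ c)))

-- For odd n, going twice round Cₙ while switching layers is a Hamiltonian path of Cₙ × K₂.
twoLaps : (n : ℕ) → ℕ → Maybe (Fin n)
twoLaps n i = linePath 6 n i <∣> linePath (6 + n) n i

hamiltonianTrack : ∀ n → Track (n * 2)
hamiltonianTrack n = lift zero (twoLaps n)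

module _ {n : ℕ} where

  twoLaps-just : ∀ {i} {c : Fin n} → twoLaps n i ≡ just c → i ≡ 6 + toℕ c ⊎ i ≡ 6 + n + toℕ c
  twoLaps-just {i} eq with linePath 6 n i in L₁
  ... | just _  = inj₁ (linePath-just 6 (trans L₁ eq))
  ... | nothing = inj₂ (linePath-just (6 + n) eq)

  hamiltonian-first : ∀ {k} → k < n → hamiltonianTrack n (6 + k) ≡ copyWalk n zero k
  hamiltonian-first {k} k<n with linePath-below {n} k<n
  ... | c , Lc rewrite Lc = refl

  hamiltonian-second : n % 2 ≡ 1 → ∀ k → hamiltonianTrack n (6 + (n + k)) ≡ copyWalk n (suc zero) k
  hamiltonian-second odd k
    rewrite linePath-beyond (m≤m+n n k) | linePath-shift n {n} {k} | layer-+ zero n k | layer-odd zero n odd = refl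

  twoLaps-adjacent : ∀ {i} {c c′ : Fin n} → twoLaps n i ≡ just c → twoLaps n (suc i) ≡ just c′ →
                     CycleAdj n c c′
  twoLaps-adjacent {i} {c} {c′} Tc Tc′ with twoLaps-just {i} Tc | twoLaps-just {suc i} Tc′
  ... | inj₁ p | inj₁ q = inj₁ (inj₁ (+-cancelˡ-≡ 6 _ _ (trans (cong suc (sym p)) q)))
  ... | inj₂ p | inj₂ q =
    inj₁ (inj₁ (+-cancelˡ-≡ (6 + n) _ _ (trans (+-suc (6 + n) (toℕ c)) (trans (cong suc (sym p)) q))))
  ... | inj₁ p | inj₂ q = inj₂ (inj₂ (c′≡0 , trans wrap (trans (cong (n +_) c′≡0) (+-identityʳ n))))
    where
    wrap : suc (toℕ c) ≡ n + toℕ c′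
    wrap = +-cancelˡ-≡ 6 _ _ (trans (cong suc (sym p)) q)
    c′≡0 : toℕ c′ ≡ 0
    c′≡0 = n≤0⇒n≡0 (+-cancelˡ-≤ n _ _ (begin
      n + toℕ c′    ≡⟨ wrap ⟨
      suc (toℕ c)   ≤⟨ toℕ<n c ⟩
      n             ≡⟨ +-identityʳ n ⟨
      n + 0         ∎))
      where open ≤-Reasoning
  ... | inj₂ p | inj₁ q =
    ⊥-elim (<⇒≱ (toℕ<n c′) (≤-trans (m≤m+n n _) (≤-reflexive (+-cancelˡ-≡ 6 _ _ late))))
    where
    late : 6 + (n + suc (toℕ c)) ≡ 6 + toℕ c′
    late = trans (cong (6 +_) (+-suc n (toℕ c))) (trans (cong suc (sym p)) q)

  twoLaps-first : (c : Fin n) → twoLaps n (6 + toℕ c) ≡ just c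
  twoLaps-first c = cong (_<∣> linePath (6 + n) n (6 + toℕ c)) (linePath-at 6 c refl)

  twoLaps-second : (c : Fin n) → twoLaps n (6 + n + toℕ c) ≡ just c
  twoLaps-second c rewrite linePath-beyond (m≤m+n n (toℕ c)) = linePath-at (6 + n) c refl

module _ {n : ℕ} (odd : n % 2 ≡ 1) where

  private
    layer-lap : ∀ k → layer zero (n + k) ≡ opposite (layer zero k)
    layer-lap k =
      trans (layer-+ zero n k) (trans (cong (λ b → layer b k) (layer-odd zero n odd)) (layer-opposite zero k))

  hamiltonianCover : PathCover (CycleAdj n ×K₂) {⊤} (λ _ → hamiltonianTrack n)
  hamiltonianCover = record
    { adjacent  = λ {_} {i} → lift-adjacent (twoLaps n) zero (λ {i} → twoLaps-adjacent {n} {i}) {i}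
    ; injective = λ Tx T′x → refl , injective Tx T′x
    ; covers    = covers
    }
    where
    injective : ∀ {i i′ x} → hamiltonianTrack n i ≡ just x → hamiltonianTrack n i′ ≡ just x →
                i ≡ i′
    injective {i} {i′} Tx T′x with lift-just (twoLaps n) zero {i} Tx | lift-just (twoLaps n) zero {i′} T′x
    ... | c , Lc , refl | c′ , Lc′ , eq with combine-injective c _ c′ _ eq
    ...   | refl , layers with twoLaps-just {n} {i} Lc | twoLaps-just {n} {i′} Lc′
    ...     | inj₁ p    | inj₁ q    = trans p (sym q)
    ...     | inj₂ p    | inj₂ q    = trans p (sym q)
    ...     | inj₁ refl | inj₂ refl = ⊥-elim (opposite-≢ _ (sym (trans layers (layer-lap (toℕ c)))))
    ...     | inj₂ refl | inj₁ refl = ⊥-elim (opposite-≢ _ (trans (sym (layer-lap (toℕ c))) layers))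
    covers : ∀ x → ∃₂ λ (_ : ⊤) j → hamiltonianTrack n (3 + j) ≡ just x
    covers x with combine-surjective {n} {2} x
    ... | c , b , refl with b ≟ᶠ layer zero (toℕ c)
    ...   | yes refl = tt , 3 + toℕ c , lift-at (twoLaps n) zero {6 + toℕ c} (twoLaps-first c)
    ...   | no b≢    = tt , 3 + (n + toℕ c) ,
      trans (lift-at (twoLaps n) zero {6 + n + toℕ c} (twoLaps-second c))
            (cong (λ b′ → just (combine c b′))
                  (trans (layer-lap (toℕ c)) (sym (≢⇒opposite λ eq → b≢ (sym eq)))))

-- Optimal rows

rowSite : ℕ → (ℕ → Bool) → ℕ → Site
rowSite n r k = if k <ᵇ n then member (r k) else void

rowSite-below : ∀ {n} r {k} → k < n → rowSite n r k ≡ member (r k)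
rowSite-below {n} r {k} k<n with k <ᵇ n | <⇒<ᵇ k<n
... | true | _ = refl

rowSite-beyond : ∀ {n} r {k} → n ≤ k → rowSite n r k ≡ void
rowSite-beyond {n} r {k} n≤k with k <ᵇ n | <ᵇ⇒< k n
... | false | _   = refl
... | true  | k<n = ⊥-elim (<⇒≱ (k<n _) n≤k)

rowSet : ∀ n → (Fin 2 → ℕ → Bool) → Subset (n * 2)
rowSet n g = tabulate λ x → let c , b = remQuot {n} 2 x in g (layer b (toℕ c)) (toℕ c)

rowSet-lookup : ∀ n g e (c : Fin n) → lookup (rowSet n g) (combine c (layer e (toℕ c))) ≡ g e (toℕ c)
rowSet-lookup n g e c = begin
  lookup (rowSet n g) (combine c b)  ≡⟨ lookup∘tabulate _ (combine c b) ⟩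
  read (remQuot {n} 2 (combine c b)) ≡⟨ cong read (remQuot-combine c b) ⟩
  g (layer b (toℕ c)) (toℕ c)        ≡⟨ cong (λ b′ → g b′ (toℕ c)) (layer-involutive e (toℕ c)) ⟩
  g e (toℕ c)                        ∎
  where
  open ≡-Reasoning
  b = layer e (toℕ c)
  read : Fin n × Fin 2 → Bool
  read (c′ , b′) = g (layer b′ (toℕ c′)) (toℕ c′)

copy-rowSet : ∀ n g e k → wordOf (rowSet n g) (copyWalk n e) k ≡ rowSite n (g e) k
copy-rowSet n g e k with k <? n
... | no k≮n = trans (cong (λ m → siteOf (rowSet n g) (Maybe.map (λ c → combine c (layer e k)) m))
                           (linePath-beyond (≮⇒≥ k≮n)))
                     (sym (rowSite-beyond (g e) (≮⇒≥ k≮n)))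
... | yes k<n with linePath-below {n} k<n
...   | c , Lc with linePath-just 0 Lc
...     | refl = trans (cong (siteOf (rowSet n g)) (lift-at (linePath 0 n) e Lc))
                       (trans (cong member (rowSet-lookup n g e c)) (sym (rowSite-below (g e) k<n)))

rowSet-size : ∀ n g → ∣ rowSet n g ∣ ≡ ∑[ k < n ] guarded (member (g zero k))
                                     + ∑[ k < n ] guarded (member (g (suc zero) k))
rowSet-size n g =
  trans (∣S∣≡inCopy₀+inCopy₁ n (rowSet n g)) (cong₂ _+_ (inCopy-rowSet zero) (inCopy-rowSet (suc zero)))
  where
  inCopy-rowSet : ∀ e → inCopy n (rowSet n g) e ≡ ∑[ k < n ] guarded (member (g e k))
  inCopy-rowSet e = ∑-cong n λ k k<n → cong guarded (trans (copy-rowSet n g e k) (rowSite-below (g e) k<n))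

padded : ℕ → (ℕ → Bool) → Word
padded n r (suc (suc (suc (suc (suc (suc k)))))) = rowSite n r k
padded n r _                                     = void

path-rowSet : ∀ n g e j → wordOf (rowSet n g) (pathTrack n e) j ≡ padded n (g e) j
path-rowSet n g e (suc (suc (suc (suc (suc (suc k)))))) = copy-rowSet n g e k
path-rowSet n g e 0 = refl
path-rowSet n g e 1 = refl
path-rowSet n g e 2 = refl
path-rowSet n g e 3 = refl
path-rowSet n g e 4 = refl
path-rowSet n g e 5 = refl

rowSite-shift : ∀ n {m} r k → rowSite (n + m) r (n + k) ≡ rowSite m (λ i → r (n + i)) k
rowSite-shift zero    r k = refl
rowSite-shift (suc n) r k = rowSite-shift n (λ i → r (suc i)) k

halves : ℕ → (ℕ → Bool) → Fin 2 → ℕ → Bool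
halves n p zero       = p
halves n p (suc zero) = λ k → p (n + k)

module _ {n : ℕ} (odd : n % 2 ≡ 1) where

  hamiltonian-rowSet : ∀ p j → wordOf (rowSet n (halves n p)) (hamiltonianTrack n) j ≡ padded (n + n) p j
  hamiltonian-rowSet p (suc (suc (suc (suc (suc (suc k)))))) with k <? n
  ... | yes k<n = begin
    wordOf (rowSet n (halves n p)) (hamiltonianTrack n) (6 + k) ≡⟨ cong (siteOf _) (hamiltonian-first k<n) ⟩
    wordOf (rowSet n (halves n p)) (copyWalk n zero) k          ≡⟨ copy-rowSet n (halves n p) zero k ⟩
    rowSite n p k                                               ≡⟨ rowSite-below p k<n ⟩
    member (p k)                                                ≡⟨ rowSite-below p (≤-trans k<n (m≤m+n n n)) ⟨
    rowSite (n + n) p k                                         ∎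
    where open ≡-Reasoning
  ... | no k≮n with m≤n⇒∃[o]m+o≡n (≮⇒≥ k≮n)
  ...   | k′ , refl = trans (cong (siteOf _) (hamiltonian-second {n} odd k′))
                            (trans (copy-rowSet n (halves n p) (suc zero) k′) (sym (rowSite-shift n p k′)))
  hamiltonian-rowSet p 0 = refl
  hamiltonian-rowSet p 1 = refl
  hamiltonian-rowSet p 2 = refl
  hamiltonian-rowSet p 3 = refl
  hamiltonian-rowSet p 4 = refl
  hamiltonian-rowSet p 5 = refl

below? : ∀ {P : ℕ → Set} L → (∀ j → Dec (P j)) → Dec (∀ j → j < L → P j)
below? zero    P? = yes λ _ ()
below? (suc L) P? = map′ (λ { (p₀ , p) zero _ → p₀ ; (p₀ , p) (suc j) (s≤s j<L) → p j j<L })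
                         (λ p → p 0 z<s , λ j j<L → p (suc j) (s≤s j<L))
                         (P? 0 ×-dec below? L (λ j → P? (suc j)))

dominatingRow : ℕ → ℕ → Bool
dominatingRow (suc (suc (suc n))) (suc (suc (suc k))) = dominatingRow n k
dominatingRow _ 1 = true
dominatingRow 1 0 = true
dominatingRow _ _ = false

-- The window at 9 + k is the window at 6 + k of the row three sites shorter, and all rows of
-- length at least 12 share their first nine windows; the remaining windows are checked.
dominatingRow-valid : ∀ n j → DominatedAt (padded n (dominatingRow n)) j
dominatingRow-tail : ∀ n k → DominatedAt (padded n (dominatingRow n)) (9 + k)
dominatingRow-valid n j with j <? 9 | n <? 12
... | yes j<9 | yes n<12 =
  toWitness {a? = below? 12 λ n → below? 9 λ j → dominatedAt? (padded n (dominatingRow n)) j} _ n n<12 j j<9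
... | yes j<9 | no n≮12 = let m , 12+m≡n = m≤n⇒∃[o]m+o≡n (≮⇒≥ n≮12) in
  subst (λ n → DominatedAt (padded n (dominatingRow n)) j) 12+m≡n
    (toWitness {a? = below? 9 λ j → dominatedAt? (padded (12 + m) (dominatingRow (12 + m))) j} _ j j<9)
... | no j≮9 | _ = let k , 9+k≡j = m≤n⇒∃[o]m+o≡n (≮⇒≥ j≮9) in
  subst (DominatedAt (padded n (dominatingRow n))) 9+k≡j (dominatingRow-tail n k)
dominatingRow-tail 0 k ()
dominatingRow-tail 1 k ()
dominatingRow-tail 2 k ()
dominatingRow-tail (suc (suc (suc n))) k = dominatingRow-valid n (6 + k)

dominatingRow-size : ∀ n → ∑[ k < n ] guarded (member (dominatingRow n k)) ≡ ⌈ n / 3 ⌉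
dominatingRow-size 0 = refl
dominatingRow-size 1 = refl
dominatingRow-size 2 = refl
dominatingRow-size (suc (suc (suc n))) = trans (cong suc (dominatingRow-size n)) (sym (⌈⌉-+ 1 n 2))

secureRow : ℕ → ℕ → Bool
secureRow (suc (suc (suc (suc (suc (suc (suc n))))))) (suc (suc (suc (suc (suc (suc (suc k))))))) = secureRow n k
secureRow _ 1 = true
secureRow _ 3 = true
secureRow _ 5 = true
secureRow 1 0 = true
secureRow 3 2 = true
secureRow 5 4 = true
secureRow _ _ = false

secureRow-valid : ∀ n j → SecuredAt (padded n (secureRow n)) j
secureRow-tail : ∀ n k → SecuredAt (padded n (secureRow n)) (13 + k)
secureRow-valid n j with j <? 13 | n <? 20
... | yes j<13 | yes n<20 =
  toWitness {a? = below? 20 λ n → below? 13 λ j → securedAt? (padded n (secureRow n)) j} _ n n<20 j j<13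
... | yes j<13 | no n≮20 = let m , 20+m≡n = m≤n⇒∃[o]m+o≡n (≮⇒≥ n≮20) in
  subst (λ n → SecuredAt (padded n (secureRow n)) j) 20+m≡n
    (toWitness {a? = below? 13 λ j → securedAt? (padded (20 + m) (secureRow (20 + m))) j} _ j j<13)
... | no j≮13 | _ = let k , 13+k≡j = m≤n⇒∃[o]m+o≡n (≮⇒≥ j≮13) in
  subst (SecuredAt (padded n (secureRow n))) 13+k≡j (secureRow-tail n k)
secureRow-tail 0 k ()
secureRow-tail 1 k ()
secureRow-tail 2 k ()
secureRow-tail 3 k ()
secureRow-tail 4 k ()
secureRow-tail 5 k ()
secureRow-tail 6 k ()
secureRow-tail (suc (suc (suc (suc (suc (suc (suc n))))))) k = secureRow-valid n (6 + k)

secureRow-size : ∀ n → ∑[ k < n ] guarded (member (secureRow n k)) ≡ ⌈ 3 * n / 7 ⌉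
secureRow-size 0 = refl
secureRow-size 1 = refl
secureRow-size 2 = refl
secureRow-size 3 = refl
secureRow-size 4 = refl
secureRow-size 5 = refl
secureRow-size 6 = refl
secureRow-size (suc (suc (suc (suc (suc (suc (suc n))))))) = begin
  3 + ∑[ k < n ] guarded (member (secureRow n k)) ≡⟨ cong (3 +_) (secureRow-size n) ⟩
  3 + ⌈ 3 * n / 7 ⌉                               ≡⟨ ⌈⌉-+ 3 (3 * n) 6 ⟨
  ⌈ 3 * 7 + 3 * n / 7 ⌉                           ≡⟨ cong (λ a → ⌈ a / 7 ⌉) (*-distribˡ-+ 3 7 n) ⟨
  ⌈ 3 * (7 + n) / 7 ⌉                             ∎
  where open ≡-Reasoning

-- Domination numbers of Pₙ × K₂ and Cₙ × K₂

module LocalDomination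
  (Property : (N : ℕ) → Rel (Fin N) 0ℓ → Subset N → Set)
  (Window : Word → ℕ → Set)
  (γ : ℕ → ℕ)
  (window-cong : ∀ {w w′} j → (∀ i → w i ≡ w′ i) → Window w j → Window w′ j)
  (mono : ∀ {N} {Adj Adj′ : Rel (Fin N) 0ℓ} {S} → Adj ⇒ Adj′ → Property N Adj S → Property N Adj′ S)
  (necessary : ∀ {N} {Adj : Rel (Fin N) 0ℓ} {S} {T : Track N} →
               InducedWalk Adj T → Apart 3 T → Property N Adj S → ∀ j → Window (wordOf S T) j)
  (sufficient : ∀ {N} {Adj : Rel (Fin N) 0ℓ} {S} {E} {T : E → Track N} →
                PathCover Adj T → Symmetric Adj → (∀ e j → Window (wordOf S (T e)) j) → Property N Adj S)
  (bound : ∀ w L → Wraps w L → (∀ j → j < L → Window w j) →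
           γ (∑[ j < L ] present (w j)) ≤ ∑[ j < L ] guarded (w j))
  (row : ℕ → ℕ → Bool)
  (row-valid : ∀ n j → Window (padded n (row n)) j)
  (row-size : ∀ n → ∑[ k < n ] guarded (member (row n k)) ≡ γ n)
  where

  path-lower : ∀ n S → Property (n * 2) (PathAdj n ×K₂) S → ∀ e → γ n ≤ inCopy n S e
  path-lower n S P e = subst (λ p → γ p ≤ inCopy n S e) (path-present S e)
    (bound (wordOf S (pathTrack n e)) (6 + n) (path-wraps S e) λ j _ →
      necessary (lift-induced (linePath 6 n) e {PathAdj n} (linePath-induced 6))
                (λ {i} → lift-apart₃ (linePath 6 n) e {i}) P j)

  cycle-lower : ∀ n .{{_ : NonZero n}} → 3 ≤ n → ∀ S → Property (n * 2) (CycleAdj n ×K₂) S →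
                ∀ e L → (∀ j → cycleTrack n e (j + L) ≡ cycleTrack n e j) →
                γ L ≤ ∑[ j < L ] guarded (wordOf S (cycleTrack n e) j)
  cycle-lower n 3≤n S P e L period =
    subst (λ p → γ p ≤ ∑[ j < L ] guarded (wordOf S (cycleTrack n e) j)) (cycle-present e S L)
      (bound (wordOf S (cycleTrack n e)) L (periodic-wraps {S = S} period) λ j _ →
        necessary (lift-induced (cycleWalk n) e {CycleAdj n} (cycleWalk-induced 3≤n))
                  (λ {i} → lift-apart₃ (cycleWalk n) e {i}) P j)

  both-copies-lower : ∀ n (S : Subset (n * 2)) → (∀ e → γ n ≤ inCopy n S e) → 2 * γ n ≤ ∣ S ∣
  both-copies-lower n S lower = begin
    2 * γ n                                 ≡⟨ cong (γ n +_) (+-identityʳ (γ n)) ⟩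
    γ n + γ n                               ≤⟨ +-mono-≤ (lower zero) (lower (suc zero)) ⟩
    inCopy n S zero + inCopy n S (suc zero) ≡⟨ ∣S∣≡inCopy₀+inCopy₁ n S ⟨
    ∣ S ∣                                   ∎
    where open ≤-Reasoning

  pathWitness : ∀ n → Subset (n * 2)
  pathWitness n = rowSet n (λ _ → row n)

  pathWitness-size : ∀ n → ∣ pathWitness n ∣ ≡ 2 * γ n
  pathWitness-size n = begin
    ∣ pathWitness n ∣ ≡⟨ rowSet-size n (λ _ → row n) ⟩
    R + R             ≡⟨ cong₂ _+_ (row-size n) (row-size n) ⟩
    γ n + γ n         ≡⟨ cong (γ n +_) (+-identityʳ (γ n)) ⟨
    2 * γ n           ∎
    where
    open ≡-Reasoning
    R = ∑[ k < n ] guarded (member (row n k))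

  pathWitness-windows : ∀ n e j → Window (wordOf (pathWitness n) (pathTrack n e)) j
  pathWitness-windows n e j = window-cong j (λ i → sym (path-rowSet n _ e i)) (row-valid n j)

  path-value : ∀ n → MinSize (n * 2) (Property (n * 2) (PathAdj n ×K₂)) (2 * γ n)
  path-value n =
    (pathWitness n ,
     sufficient (pathCover n) (×K₂-sym (PathAdj n) (pathAdj-sym n)) (pathWitness-windows n) ,
     pathWitness-size n) ,
    λ S P → both-copies-lower n S (path-lower n S P)

  evenCycle-lower : ∀ n → 2 ≤ n → n % 2 ≡ 0 → ∀ S → Property (n * 2) (CycleAdj n ×K₂) S →
                    ∀ e → γ n ≤ inCopy n S e
  evenCycle-lower 2 _ _ S P =
    path-lower 2 S (mono (λ {x} {y} → ×K₂-mono {A = CycleAdj 2} cycle₂⇒path₂ {x} {y}) P)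
  evenCycle-lower n@(suc (suc (suc _))) _ even S P e =
    subst (γ n ≤_) (cycle-lap {n} e S) (cycle-lower n (m≤m+n 3 _) S P e n (cycleTrack-even-period e even))

  evenCycle-value : ∀ n → 2 ≤ n → n % 2 ≡ 0 →
                    MinSize (n * 2) (Property (n * 2) (CycleAdj n ×K₂)) (2 * γ n)
  evenCycle-value n 2≤n even =
    (pathWitness n ,
     sufficient (pathCover-mono (×K₂-mono {A = PathAdj n} {CycleAdj n} inj₁) (pathCover n))
                (×K₂-sym (CycleAdj n) (cycleAdj-sym n)) (pathWitness-windows n) ,
     pathWitness-size n) ,
    λ S P → both-copies-lower n S (evenCycle-lower n 2≤n even S P)

  oddCycle-value : ∀ n → 2 ≤ n → n % 2 ≡ 1 →
                   MinSize (n * 2) (Property (n * 2) (CycleAdj n ×K₂)) (γ (n + n))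
  oddCycle-value n 2≤n odd =
    (witness , sufficient (hamiltonianCover odd) (×K₂-sym (CycleAdj n) (cycleAdj-sym n)) windows , size) ,
    λ S P → subst (γ (n + n) ≤_) (both-laps S)
                  (cycle-lower n 3≤n S P zero (n + n) (cycleTrack-double-period zero))
    where
    3≤n : 3 ≤ n
    3≤n = ≤∧≢⇒< 2≤n λ { refl → 0≢1+n odd }
    instance
      n≢0 : NonZero n
      n≢0 = >-nonZero (≤-trans (s≤s z≤n) 2≤n)
    witness : Subset (n * 2)
    witness = rowSet n (halves n (row (n + n)))
    windows : ∀ (_ : ⊤) j → Window (wordOf witness (hamiltonianTrack n)) j
    windows _ j = window-cong j (λ i → sym (hamiltonian-rowSet odd _ i)) (row-valid (n + n) j)
    size : ∣ witness ∣ ≡ γ (n + n)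
    size = begin
      ∣ witness ∣                                     ≡⟨ rowSet-size n (halves n (row (n + n))) ⟩
      ∑[ k < n ] r k + ∑[ k < n ] r (n + k)           ≡⟨ ∑-+ n n r ⟨
      ∑[ k < n + n ] r k                              ≡⟨ row-size (n + n) ⟩
      γ (n + n)                                       ∎
      where
      open ≡-Reasoning
      r : ℕ → ℕ
      r k = guarded (member (row (n + n) k))
    both-laps : ∀ S → ∑[ j < n + n ] guarded (wordOf S (cycleTrack n zero) j) ≡ ∣ S ∣
    both-laps S = begin
      ∑[ j < n + n ] guarded (wordOf S (cycleTrack n zero) j) ≡⟨ cycle-laps zero S ⟩
      inCopy n S zero + inCopy n S (layer zero n)
        ≡⟨ cong (λ e → inCopy n S zero + inCopy n S e) (layer-odd zero n odd) ⟩
      inCopy n S zero + inCopy n S (suc zero)                  ≡⟨ ∣S∣≡inCopy₀+inCopy₁ n S ⟨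
      ∣ S ∣                                                    ∎
      where open ≡-Reasoning

module Domination = LocalDomination Dominating DominatedAt (λ n → ⌈ n / 3 ⌉)
  dominatedAt-cong dominating-mono
  (λ walk _ → dominated-necessary walk)
  (λ cover Adj-sym dom → dominated-sufficient cover Adj-sym λ e j → dom e (2 + j))
  dominated-bound dominatingRow dominatingRow-valid dominatingRow-size

module SecureDomination = LocalDomination SecureDominating SecuredAt (λ n → ⌈ 3 * n / 7 ⌉)
  securedAt-cong secureDominating-mono
  (λ walk apart₃ → secured-necessary walk apart₃)
  (λ cover Adj-sym → secured-sufficient cover Adj-sym)
  secured-bound secureRow secureRow-valid secureRow-size

proposition2p2 : (n : ℕ) → 2 ≤ n →
    DominationNumberIs (n * 2) (PnK2 n) (2 * ⌈ n / 3 ⌉)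
    × ((n % 2 ≡ 1 → DominationNumberIs (n * 2) (CnK2 n) ⌈ 2 * n / 3 ⌉)
    × (n % 2 ≡ 0 → DominationNumberIs (n * 2) (CnK2 n) (2 * ⌈ n / 3 ⌉)))
    × SecureDominationNumberIs (n * 2) (PnK2 n) (2 * ⌈ 3 * n / 7 ⌉)
    × ((n % 2 ≡ 1 → SecureDominationNumberIs (n * 2) (CnK2 n) ⌈ 6 * n / 7 ⌉)
    × (n % 2 ≡ 0 → SecureDominationNumberIs (n * 2) (CnK2 n) (2 * ⌈ 3 * n / 7 ⌉)))
proposition2p2 n 2≤n =
  Domination.path-value n ,
  ((λ odd → subst (DominationNumberIs (n * 2) (CnK2 n)) (cong (λ a → ⌈ a / 3 ⌉) n+n≡2*n)
                  (Domination.oddCycle-value n 2≤n odd)) ,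
   Domination.evenCycle-value n 2≤n) ,
  SecureDomination.path-value n ,
  ((λ odd → subst (SecureDominationNumberIs (n * 2) (CnK2 n)) (cong (λ a → ⌈ a / 7 ⌉) 3*[n+n]≡6*n)
                  (SecureDomination.oddCycle-value n 2≤n odd)) ,
   SecureDomination.evenCycle-value n 2≤n)
  where
  n+n≡2*n : n + n ≡ 2 * n
  n+n≡2*n = cong (n +_) (sym (+-identityʳ n))
  3*[n+n]≡6*n : 3 * (n + n) ≡ 6 * n
  3*[n+n]≡6*n = trans (cong (3 *_) n+n≡2*n) (sym (*-assoc 3 2 n))
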